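{- For a finite set $X$ and a function $f\colon X\to X$ define the degree of noninvertibility $\deg(f)=\frac{1}{|X|}\sum_{x\in X}|f^{ -1}(f(x))|$, and let $f^2=f\circ f$. If the limit $$\lim_{n\to\infty}\ \max_{\substack{f\colon X\to X\\ |X|=n}}\frac{\deg(f^2)}{\deg(f)^{3/2}}\cdot\frac{1}{n^{1/2}}$$ exists, then it is at least $2\cdot 3^{ -3/2}$.
   Context: The maximum is over all functions $f$ from a set $X$ of size $n$ to itself. -}

module Defs where

open import Data.Nat as ℕ using (ℕ; zero; suc; _≤_)
open import Data.Integer using (+_)
open import Data.Fin using (Fin) renaming (zero to fzero)
open import Data.Fin.Properties using (_≟_)
open import Data.Nat.ListAction using (sum)
open import Data.List using (List; []; _∷_; length; filter; map; allFin; concatMap; foldr; [_])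
open import Data.List.Membership.Propositional using (_∈_)
open import Data.List.Membership.Propositional.Properties using (∈-filter⁺; ∈-allFin)
open import Data.List.Relation.Unary.Any using (here; there)
open import Data.Vec using (Vec; lookup) renaming ([] to []ᵥ; _∷_ to _∷ᵥ_)
open import Data.Rational using (ℚ; _/_; _*_; _÷_; _⊔_; Positive; 0ℚ)
open import Data.Rational.Properties using (normalize-pos; pos*pos⇒pos; pos⇒nonZero)
open import Relation.Binary.PropositionalEquality using (refl)

-- A finite set of size n is modelled as Fin n (everything below is
-- invariant under bijections, so this loses no generality).

fibreSize : ∀ {n} → (Fin n → Fin n) → Fin n → ℕ
fibreSize {n} f x = length (filter (λ y → f y ≟ f x) (allFin n))

fibreSum : ∀ {n} → (Fin n → Fin n) → ℕ
fibreSum {n} f = sum (map (fibreSize f) (allFin n))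

private
  ∈⇒nonZeroLength : ∀ {A : Set} {x : A} {xs : List A} → x ∈ xs → ℕ.NonZero (length xs)
  ∈⇒nonZeroLength (here _)  = _
  ∈⇒nonZeroLength (there _) = _

  nz+ : ∀ a b → ℕ.NonZero a → ℕ.NonZero (a ℕ.+ b)
  nz+ (suc a) b _ = _

fibreSize-nonZero : ∀ {n} (f : Fin n → Fin n) x → ℕ.NonZero (fibreSize f x)
fibreSize-nonZero {n} f x = ∈⇒nonZeroLength (∈-filter⁺ (λ y → f y ≟ f x) (∈-allFin x) refl)

fibreSum-nonZero : ∀ {k} (f : Fin (suc k) → Fin (suc k)) → ℕ.NonZero (fibreSum f)
fibreSum-nonZero f = nz+ (fibreSize f fzero) _ (fibreSize-nonZero f fzero)

deg : ∀ {k} → (Fin (suc k) → Fin (suc k)) → ℚ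
deg {k} f = + fibreSum f / suc k

deg-pos : ∀ {k} (f : Fin (suc k) → Fin (suc k)) → Positive (deg f)
deg-pos {k} f = normalize-pos (fibreSum f) (suc k) {{_}} {{fibreSum-nonZero f}}

denom : ∀ {k} → (Fin (suc k) → Fin (suc k)) → ℚ
denom {k} f = deg f * deg f * deg f * (+ suc k / 1)

denom-pos : ∀ {k} (f : Fin (suc k) → Fin (suc k)) → Positive (denom f)
denom-pos {k} f =
  pos*pos⇒pos (deg f * deg f * deg f) {{pos*pos⇒pos (deg f * deg f) {{pos*pos⇒pos (deg f) {{p}} (deg f) {{p}}}} (deg f) {{p}}}}
              (+ suc k / 1) {{normalize-pos (suc k) 1}}
  where p = deg-pos f

-- The SQUARE of the quantity in the paper:
--   ( deg(f²) / (deg(f)^{3/2} · n^{1/2}) )²  =  deg(f∘f)² / (deg(f)³ · n)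
ratio² : ∀ {k} → (Fin (suc k) → Fin (suc k)) → ℚ
ratio² f = (deg (λ x → f (f x)) * deg (λ x → f (f x))) ÷ denom f
  where instance _ = pos⇒nonZero (denom f) {{denom-pos f}}

allVecs : ∀ n m → List (Vec (Fin n) m)
allVecs n zero    = [ []ᵥ ]
allVecs n (suc m) = concatMap (λ i → map (i ∷ᵥ_) (allVecs n m)) (allFin n)

allFuns : ∀ n → List (Fin n → Fin n)
allFuns n = map lookup (allVecs n n)

-- M k = max over all f : X → X with |X| = k+1 of ratio²(f).
-- (The fold starts at 0, harmless since every ratio² is positive and the list is nonempty.)
maxRatio² : ℕ → ℚ
maxRatio² k = foldr _⊔_ 0ℚ (map ratio² (allFuns (suc k)))

{-# OPTIONS --safe #-}
-- Take X = {0, …, n-1} with n = c + b + c·b and f y = ⌊(y ∸ c)/b⌋.  The points below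
-- c + b form one fibre and the remaining c·b points split into c fibres of size b;
-- every value of f is at most c, so f² is constant.  The powers of n cancel in ratio²,
-- which is (Σₓ |(f²)⁻¹(f² x)|)² / (Σₓ |f⁻¹(f x)|)³ ≥ n⁴ / ((c + b)² + c·b²)³, and for
-- c = 2s², b = 2s this is at least 4/27 (the leading coefficients in s agree).  So
-- maxRatio² is at least 4/27 at arbitrarily large sizes, and a Cauchy sequence with that
-- property is eventually above 4/27 - ε.
module Submission where

open import Defs
open import Data.Nat using (ℕ) renaming (_≤_ to _≤ℕ_)
open import Data.Integer using (+_)
open import Data.Product using (∃-syntax)
open import Data.Rational using (ℚ; _/_; _-_; ∣_∣; _≤_; Positive)

open import Data.Nat using (zero; suc; pred; _+_; _*_; _∸_; _<_; z≤n; s≤s; s≤s⁻¹; z<s; s<s; s<s⁻¹; NonZero; >-nonZero⁻¹)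
open import Data.Nat.Properties
import Data.Nat.DivMod as ℕ
open import Data.Nat.ListAction using (sum)
open import Data.Nat.Tactic.RingSolver using (solve-∀)
import Data.Integer as ℤ
import Data.Integer.Properties as ℤ
import Data.Rational as ℚ
import Data.Rational.Properties as ℚ
import Data.Rational.Unnormalised as ℚᵘ
import Data.Rational.Unnormalised.Properties as ℚᵘ
open import Data.Rational.Solver using (module +-*-Solver)
open import Data.Fin using (Fin; toℕ; fromℕ<) renaming (zero to fzero; suc to fsuc)
open import Data.Fin.Properties using (toℕ<n; toℕ-fromℕ<; toℕ-injective) renaming (_≟_ to _≟ᶠ_)
open import Data.List using (List; _∷_; length; filter; map; tabulate; allFin; foldr)
open import Data.List.Properties using (filter-all; filter-≐; length-tabulate; map-tabulate; tabulate-cong; map-cong)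
open import Data.List.Relation.Unary.All using (universal)
open import Data.List.Relation.Unary.Any using (here; there)
open import Data.List.Membership.Propositional using (_∈_)
open import Data.List.Membership.Propositional.Properties using (∈-map⁺; ∈-concat⁺′; ∈-allFin)
open import Data.Vec using (Vec; lookup) renaming ([] to []ᵥ; _∷_ to _∷ᵥ_)
import Data.Vec as Vec
open import Data.Vec.Properties using (lookup∘tabulate)
open import Data.Product using (_×_; _,_; proj₂)
open import Data.Sum using (inj₁; inj₂)
open import Function using (id; _∘_)
open import Relation.Binary.PropositionalEquality
open import Relation.Nullary using (yes; no; contradiction)
open import Relation.Unary using (Pred; Decidable)

module _ {a p} {A : Set a} {P : Pred A p} (P? : Decidable P) where

  length-filter-tabulate≤ : ∀ {n} (e : Fin n → A) lo w →
    (∀ i → P (e i) → lo ≤ℕ toℕ i × toℕ i < lo + w) → length (filter P? (tabulate e)) ≤ℕ w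
  length-filter-tabulate≤ {zero} e lo w inside = z≤n
  length-filter-tabulate≤ {suc n} e lo w inside with P? (e fzero)
  ... | yes P₀ with inside fzero P₀
  ...   | z≤n , s≤s _ = s≤s (length-filter-tabulate≤ (e ∘ fsuc) 0 _
                              λ i Pi → z≤n , s<s⁻¹ (proj₂ (inside (fsuc i) Pi)))
  length-filter-tabulate≤ {suc n} e zero w inside | no _ =
    length-filter-tabulate≤ (e ∘ fsuc) 0 w λ i Pi → z≤n , <⇒≤ (proj₂ (inside (fsuc i) Pi))
  length-filter-tabulate≤ {suc n} e (suc lo) w inside | no _ =
    length-filter-tabulate≤ (e ∘ fsuc) lo w λ i Pi →
      let lo≤i , i<hi = inside (fsuc i) Pi in s≤s⁻¹ lo≤i , s<s⁻¹ i<hi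

sum-tabulate-const : ∀ n v → sum (tabulate {n = n} λ _ → v) ≡ n * v
sum-tabulate-const zero    v = refl
sum-tabulate-const (suc n) v = cong (_+_ v) (sum-tabulate-const n v)

sum-tabulate≤ : ∀ {n v} (h : Fin n → ℕ) → (∀ i → h i ≤ℕ v) → sum (tabulate h) ≤ℕ n * v
sum-tabulate≤ {zero}  h h≤v = z≤n
sum-tabulate≤ {suc n} h h≤v = +-mono-≤ (h≤v fzero) (sum-tabulate≤ (h ∘ fsuc) (h≤v ∘ fsuc))

sum-tabulate-split≤ : ∀ p {r u v} (h : Fin (p + r) → ℕ) →
  (∀ i → toℕ i < p → h i ≤ℕ u) → (∀ i → p ≤ℕ toℕ i → h i ≤ℕ v) →
  sum (tabulate h) ≤ℕ p * u + r * v
sum-tabulate-split≤ zero    h h≤u h≤v = sum-tabulate≤ h λ i → h≤v i z≤n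
sum-tabulate-split≤ (suc p) {r} {u} {v} h h≤u h≤v = begin
  h fzero + sum (tabulate (h ∘ fsuc))  ≤⟨ +-mono-≤ (h≤u fzero z<s) rest ⟩
  u + (p * u + r * v)                  ≡⟨ +-assoc u (p * u) (r * v) ⟨
  u + p * u + r * v                    ∎
  where
  open ≤-Reasoning
  rest : sum (tabulate (h ∘ fsuc)) ≤ℕ p * u + r * v
  rest = sum-tabulate-split≤ p (h ∘ fsuc) (λ i i<p → h≤u (fsuc i) (s<s i<p)) (λ i p≤i → h≤v (fsuc i) (s≤s p≤i))

toℚᵘ-/ : ∀ a b .{{_ : NonZero b}} → ℚ.toℚᵘ (+ a / b) ℚᵘ.≃ (+ a) ℚᵘ./ b
toℚᵘ-/ a (suc b) = ℚ.toℚᵘ-fromℚᵘ (ℚᵘ.mkℚᵘ (+ a) b)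

/-*-/ : ∀ a b c d .{{_ : NonZero b}} .{{_ : NonZero d}} →
        (+ a / b) ℚ.* (+ c / d) ≡ ((+ (a * c)) / (b * d)) {{m*n≢0 b d}}
/-*-/ a b@(suc _) c d@(suc _) = ℚ.toℚᵘ-injective (begin
  ℚ.toℚᵘ (+ a / b ℚ.* (+ c / d))              ≈⟨ ℚ.toℚᵘ-homo-* (+ a / b) (+ c / d) ⟩
  ℚ.toℚᵘ (+ a / b) ℚᵘ.* ℚ.toℚᵘ (+ c / d)      ≈⟨ ℚᵘ.*-cong (toℚᵘ-/ a b) (toℚᵘ-/ c d) ⟩
  (+ a ℚᵘ./ b) ℚᵘ.* (+ c ℚᵘ./ d)              ≡⟨ cong (ℚᵘ._/ (b * d)) (ℤ.pos-* a c) ⟨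
  + (a * c) ℚᵘ./ (b * d)                      ≈⟨ toℚᵘ-/ (a * c) (b * d) ⟨
  ℚ.toℚᵘ (+ (a * c) / (b * d))                ∎)
  where open ℚᵘ.≃-Reasoning

/-≤-/ : ∀ {a b c d} .{{_ : NonZero b}} .{{_ : NonZero d}} → a * d ≤ℕ c * b → + a / b ≤ + c / d
/-≤-/ {a} {b@(suc _)} {c} {d@(suc _)} ad≤cb = ℚ.toℚᵘ-cancel-≤
  (ℚᵘ.≤-respˡ-≃ (ℚᵘ.≃-sym (toℚᵘ-/ a b)) (ℚᵘ.≤-respʳ-≃ (ℚᵘ.≃-sym (toℚᵘ-/ c d))
    (ℚᵘ.*≤* (subst₂ ℤ._≤_ (ℤ.pos-* a d) (ℤ.pos-* c b) (ℤ.+≤+ ad≤cb)))))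

*≤⇒≤÷ : ∀ {p q} r .{{_ : Positive r}} → p ℚ.* r ≤ q → p ≤ (q ℚ.÷ r) {{ℚ.pos⇒nonZero r}}
*≤⇒≤÷ {p} {q} r pr≤q = ℚ.*-cancelʳ-≤-pos r (ℚ.≤-trans pr≤q (ℚ.≤-reflexive (sym q÷r*r≡q)))
  where
  instance _ = ℚ.pos⇒nonZero r
  q÷r*r≡q : q ℚ.÷ r ℚ.* r ≡ q
  q÷r*r≡q = trans (ℚ.*-assoc q (ℚ.1/ r) r) (trans (cong (q ℚ.*_) (ℚ.*-inverseˡ r)) (ℚ.*-identityʳ q))

fibreSum-cong : ∀ {n} {f g : Fin n → Fin n} → (∀ x → f x ≡ g x) → fibreSum f ≡ fibreSum g
fibreSum-cong {n} {f} {g} f≗g = cong sum (map-cong fibreSize≗ (allFin n))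
  where
  fibreSize≗ : ∀ x → fibreSize f x ≡ fibreSize g x
  fibreSize≗ x = cong length (filter-≐ (λ y → f y ≟ᶠ f x) (λ y → g y ≟ᶠ g x)
    ((λ {y} e → trans (sym (f≗g y)) (trans e (f≗g x))) , (λ {y} e → trans (f≗g y) (trans e (sym (f≗g x)))))
    (allFin n))

fibreSum-const : ∀ {n} {f : Fin n → Fin n} → (∀ x y → f x ≡ f y) → fibreSum f ≡ n * n
fibreSum-const {n} {f} const = begin
  sum (map (fibreSize f) (allFin n))  ≡⟨ cong sum (map-tabulate id (fibreSize f)) ⟩
  sum (tabulate (fibreSize f))        ≡⟨ cong sum (tabulate-cong fibreSize≡n) ⟩
  sum (tabulate {n = n} λ _ → n)      ≡⟨ sum-tabulate-const n n ⟩
  n * n                               ∎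
  where
  open ≡-Reasoning
  fibreSize≡n : ∀ x → fibreSize f x ≡ n
  fibreSize≡n x = trans (cong length (filter-all (λ y → f y ≟ᶠ f x) (universal (λ y → const y x) (allFin n))))
                        (length-tabulate id)

ratio²-lowerBound : ∀ {k} (f : Fin (suc k) → Fin (suc k)) →
  4 * (fibreSum f * fibreSum f * fibreSum f) ≤ℕ 27 * (fibreSum (f ∘ f) * fibreSum (f ∘ f)) →
  + 4 / 27 ≤ ratio² f
ratio²-lowerBound {k} f 4F₁³≤27F₂² = *≤⇒≤÷ (denom f) {{denom-pos f}} (begin
  + 4 / 27 ℚ.* denom f
    ≡⟨ cong (+ 4 / 27 ℚ.*_) denom≡ ⟩
  + 4 / 27 ℚ.* (+ (F₁ * F₁ * F₁ * n) / (n * n * n * 1))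
    ≡⟨ /-*-/ 4 27 (F₁ * F₁ * F₁ * n) (n * n * n * 1) ⟩
  + (4 * (F₁ * F₁ * F₁ * n)) / (27 * (n * n * n * 1))
    ≤⟨ /-≤-/ {4 * (F₁ * F₁ * F₁ * n)} {27 * (n * n * n * 1)} {F₂ * F₂} {n * n} cross ⟩
  + (F₂ * F₂) / (n * n)
    ≡⟨ /-*-/ F₂ n F₂ n ⟨
  deg (f ∘ f) ℚ.* deg (f ∘ f)
    ∎)
  where
  open ℚ.≤-Reasoning
  n F₁ F₂ : ℕ
  n = suc k
  F₁ = fibreSum f
  F₂ = fibreSum (f ∘ f)
  denom≡ : denom f ≡ + (F₁ * F₁ * F₁ * n) / (n * n * n * 1)
  denom≡ = begin-equality
    deg f ℚ.* deg f ℚ.* deg f ℚ.* (+ n / 1)                ≡⟨ cong (λ d → d ℚ.* deg f ℚ.* (+ n / 1)) (/-*-/ F₁ n F₁ n) ⟩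
    + (F₁ * F₁) / (n * n) ℚ.* deg f ℚ.* (+ n / 1)          ≡⟨ cong (ℚ._* (+ n / 1)) (/-*-/ (F₁ * F₁) (n * n) F₁ n) ⟩
    + (F₁ * F₁ * F₁) / (n * n * n) ℚ.* (+ n / 1)           ≡⟨ /-*-/ (F₁ * F₁ * F₁) (n * n * n) n 1 ⟩
    + (F₁ * F₁ * F₁ * n) / (n * n * n * 1)                 ∎
  cross : 4 * (F₁ * F₁ * F₁ * n) * (n * n) ≤ℕ F₂ * F₂ * (27 * (n * n * n * 1))
  cross = subst₂ _≤ℕ_ (lhs F₁ n) (rhs F₂ n) (*-monoˡ-≤ (n * n * n) 4F₁³≤27F₂²)
    where
    lhs : ∀ F n → 4 * (F * F * F) * (n * n * n) ≡ 4 * (F * F * F * n) * (n * n)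
    lhs = solve-∀
    rhs : ∀ F n → 27 * (F * F) * (n * n * n) ≡ F * F * (27 * (n * n * n * 1))
    rhs = solve-∀

allVecs-complete : ∀ n m (v : Vec (Fin n) m) → v ∈ allVecs n m
allVecs-complete n zero    []ᵥ       = here refl
allVecs-complete n (suc m) (i ∷ᵥ v) =
  ∈-concat⁺′ (∈-map⁺ (i ∷ᵥ_) (allVecs-complete n m v))
             (∈-map⁺ (λ j → map (j ∷ᵥ_) (allVecs n m)) (∈-allFin i))

∈⇒≤foldr-⊔ : ∀ {x} (xs : List ℚ) → x ∈ xs → x ≤ foldr ℚ._⊔_ ℚ.0ℚ xs
∈⇒≤foldr-⊔ (y ∷ xs) (here refl) = ℚ.p≤p⊔q y _
∈⇒≤foldr-⊔ (y ∷ xs) (there x∈xs) = ℚ.≤-trans (∈⇒≤foldr-⊔ xs x∈xs) (ℚ.p≤q⊔p y _)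

ratio²≤maxRatio² : ∀ {k} (v : Vec (Fin (suc k)) (suc k)) → ratio² (lookup v) ≤ maxRatio² k
ratio²≤maxRatio² {k} v =
  ∈⇒≤foldr-⊔ _ (∈-map⁺ ratio² (∈-map⁺ lookup (allVecs-complete (suc k) (suc k) v)))

maxRatio²-lowerBound : ∀ {k} (f : Fin (suc k) → Fin (suc k)) →
  4 * (fibreSum f * fibreSum f * fibreSum f) ≤ℕ 27 * (fibreSum (f ∘ f) * fibreSum (f ∘ f)) →
  + 4 / 27 ≤ maxRatio² k
maxRatio²-lowerBound {k} f bound = ℚ.≤-trans (ratio²-lowerBound g bound′) (ratio²≤maxRatio² (Vec.tabulate f))
  where
  g : Fin (suc k) → Fin (suc k)
  g = lookup (Vec.tabulate f)
  g≗f : ∀ x → g x ≡ f x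
  g≗f = lookup∘tabulate f
  F₁≡ : fibreSum g ≡ fibreSum f
  F₁≡ = fibreSum-cong g≗f
  F₂≡ : fibreSum (g ∘ g) ≡ fibreSum (f ∘ f)
  F₂≡ = fibreSum-cong λ x → trans (g≗f (g x)) (cong f (g≗f x))
  bound′ : 4 * (fibreSum g * fibreSum g * fibreSum g) ≤ℕ 27 * (fibreSum (g ∘ g) * fibreSum (g ∘ g))
  bound′ = subst₂ (λ F₁ F₂ → 4 * (F₁ * F₁ * F₁) ≤ℕ 27 * (F₂ * F₂)) (sym F₁≡) (sym F₂≡) bound

m<m/n*n+n : ∀ m n .{{_ : NonZero n}} → m < m ℕ./ n * n + n
m<m/n*n+n m n = begin-strict
  m                       ≡⟨ ℕ.m≡m%n+[m/n]*n m n ⟩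
  m ℕ.% n + m ℕ./ n * n   <⟨ +-monoˡ-< (m ℕ./ n * n) (ℕ.m%n<n m n) ⟩
  n + m ℕ./ n * n         ≡⟨ +-comm n (m ℕ./ n * n) ⟩
  m ℕ./ n * n + n         ∎
  where open ≤-Reasoning

module BlockMap (c b : ℕ) .{{_ : NonZero b}} where

  block : ℕ → ℕ
  block y = (y ∸ c) ℕ./ b

  block≤ : ∀ y → block y ≤ℕ y
  block≤ y = ≤-trans (ℕ.m/n≤m (y ∸ c) b) (m∸n≤m y c)

  <c+b⇒block≡0 : ∀ {y} → y < c + b → block y ≡ 0
  <c+b⇒block≡0 {y} y<c+b = ℕ.m<n⇒m/n≡0 (m<n+o⇒m∸n<o y c y<c+b)

  block≡0⇒<c+b : ∀ {y} → block y ≡ 0 → y < c + b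
  block≡0⇒<c+b {y} block≡0 = ≤-<-trans (m≤n+m∸n y c) (+-monoʳ-< c (ℕ.m/n≡0⇒m<n block≡0))

  block≡suc⇒interval : ∀ {y q} → block y ≡ suc q → c + suc q * b ≤ℕ y × y < c + suc q * b + b
  block≡suc⇒interval {y} {q} block≡1+q =
    subst (c + suc q * b ≤ℕ_) y≡c+j (+-monoʳ-≤ c qb≤j) ,
    subst (_< c + suc q * b + b) y≡c+j
      (subst (c + j <_) (sym (+-assoc c (suc q * b) b)) (+-monoʳ-< c j<qb+b))
    where
    j : ℕ
    j = y ∸ c
    qb≤j : suc q * b ≤ℕ j
    qb≤j = subst (λ q′ → q′ * b ≤ℕ j) block≡1+q (ℕ.m/n*n≤m j b)
    j<qb+b : j < suc q * b + b
    j<qb+b = subst (λ q′ → j < q′ * b + b) block≡1+q (m<m/n*n+n j b)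
    j≢0 : j ≢ 0
    j≢0 j≡0 = 1+n≢0 (trans (sym block≡1+q) (trans (cong (ℕ._/ b) j≡0) (ℕ.0/n≡0 b)))
    y≡c+j : c + j ≡ y
    y≡c+j = m+[n∸m]≡n {c} (<⇒≤ (m∸n≢0⇒n<m j≢0))

  block≤c : ∀ {y} → y < c + b + c * b → block y ≤ℕ c
  block≤c {y} y<n = s≤s⁻¹ (ℕ.m<n*o⇒m/o<n (m<n+o⇒m∸n<o y c {{m*n≢0 (suc c) b}} y<c+[1+c]b))
    where
    y<c+[1+c]b : y < c + suc c * b
    y<c+[1+c]b = subst (y <_) (+-assoc c b (c * b)) y<n

  block∘block≡0 : ∀ {y} → y < c + b + c * b → block (block y) ≡ 0
  block∘block≡0 y<n = <c+b⇒block≡0 (≤-<-trans (block≤c y<n) (m<m+n c (>-nonZero⁻¹ b)))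

  blockMap : ∀ {n} → Fin n → Fin n
  blockMap x = fromℕ< (≤-<-trans (block≤ (toℕ x)) (toℕ<n x))

  toℕ-blockMap : ∀ {n} (x : Fin n) → toℕ (blockMap x) ≡ block (toℕ x)
  toℕ-blockMap x = toℕ-fromℕ< _

  blockMap-≡⇒block-≡ : ∀ {n} {x y : Fin n} → blockMap x ≡ blockMap y → block (toℕ x) ≡ block (toℕ y)
  blockMap-≡⇒block-≡ {x = x} {y} e = trans (sym (toℕ-blockMap x)) (trans (cong toℕ e) (toℕ-blockMap y))

  blockMap²-const : ∀ {n} → n ≤ℕ c + b + c * b → ∀ (x y : Fin n) → blockMap (blockMap x) ≡ blockMap (blockMap y)
  blockMap²-const n≤ x y = toℕ-injective (trans (toℕ-blockMap² x) (sym (toℕ-blockMap² y)))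
    where
    toℕ-blockMap² : ∀ x → toℕ (blockMap (blockMap x)) ≡ 0
    toℕ-blockMap² x = trans (toℕ-blockMap (blockMap x))
      (trans (cong block (toℕ-blockMap x)) (block∘block≡0 (<-≤-trans (toℕ<n x) n≤)))

  fibreSize-blockMap-head : ∀ {n} (x : Fin n) → toℕ x < c + b → fibreSize blockMap x ≤ℕ c + b
  fibreSize-blockMap-head x x<c+b =
    length-filter-tabulate≤ (λ y → blockMap y ≟ᶠ blockMap x) id 0 (c + b)
      λ y e → z≤n , block≡0⇒<c+b (trans (blockMap-≡⇒block-≡ e) (<c+b⇒block≡0 x<c+b))

  fibreSize-blockMap-tail : ∀ {n} (x : Fin n) → c + b ≤ℕ toℕ x → fibreSize blockMap x ≤ℕ b
  fibreSize-blockMap-tail x c+b≤x = fibreSize≤b (block (toℕ x)) refl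
    where
    fibreSize≤b : ∀ q → block (toℕ x) ≡ q → fibreSize blockMap x ≤ℕ b
    fibreSize≤b zero    block≡0   = contradiction (block≡0⇒<c+b block≡0) (≤⇒≯ c+b≤x)
    fibreSize≤b (suc q) block≡1+q =
      length-filter-tabulate≤ (λ y → blockMap y ≟ᶠ blockMap x) id (c + suc q * b) b
        λ y e → block≡suc⇒interval (trans (blockMap-≡⇒block-≡ e) block≡1+q)

  fibreSum-blockMap≤ : ∀ r → fibreSum (blockMap {c + b + r}) ≤ℕ (c + b) * (c + b) + r * b
  fibreSum-blockMap≤ r = begin
    sum (map (fibreSize f) (allFin (c + b + r)))  ≡⟨ cong sum (map-tabulate id (fibreSize f)) ⟩
    sum (tabulate (fibreSize f))                 ≤⟨ sum-tabulate-split≤ (c + b) (fibreSize f)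
                                                      fibreSize-blockMap-head fibreSize-blockMap-tail ⟩
    (c + b) * (c + b) + r * b                    ∎
    where
    open ≤-Reasoning
    f : Fin (c + b + r) → Fin (c + b + r)
    f = blockMap

IsCauchy : (ℕ → ℚ) → Set
IsCauchy a = ∀ (ε : ℚ) → Positive ε → ∃[ N ] ∀ (m n : ℕ) → N ≤ℕ m → N ≤ℕ n → ∣ a m - a n ∣ ≤ ε

-p≤∣p∣ : ∀ p → ℚ.- p ≤ ∣ p ∣
-p≤∣p∣ p with ℚ.≤-total ℚ.0ℚ p
... | inj₁ 0≤p = ℚ.≤-trans (ℚ.neg-antimono-≤ 0≤p) (ℚ.0≤∣p∣ p)
... | inj₂ p≤0 = ℚ.≤-reflexive (trans (sym (ℚ.0≤p⇒∣p∣≡p (ℚ.neg-antimono-≤ p≤0))) (ℚ.∣-p∣≡∣p∣ p))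

∣p-q∣≤r⇒q-r≤p : ∀ {p q r} → ∣ p - q ∣ ≤ r → q - r ≤ p
∣p-q∣≤r⇒q-r≤p {p} {q} {r} ∣p-q∣≤r = begin
  q - r                      ≡⟨ regroup p q r ⟩
  p ℚ.+ (ℚ.- (p - q) - r)    ≤⟨ ℚ.+-monoʳ-≤ p (ℚ.+-monoˡ-≤ (ℚ.- r) (ℚ.≤-trans (-p≤∣p∣ (p - q)) ∣p-q∣≤r)) ⟩
  p ℚ.+ (r - r)              ≡⟨ cancel p r ⟩
  p                          ∎
  where
  open ℚ.≤-Reasoning
  open +-*-Solver
  regroup : ∀ p q r → q - r ≡ p ℚ.+ (ℚ.- (p - q) - r)
  regroup = solve 3 (λ p q r → q :- r := p :+ (:- (p :- q) :- r)) refl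
  cancel : ∀ p r → p ℚ.+ (r - r) ≡ p
  cancel = solve 2 (λ p r → p :+ (r :- r) := p) refl

cauchy∧frequently⇒eventually : ∀ {a : ℕ → ℚ} {l} → IsCauchy a → (∀ N → ∃[ m ] N ≤ℕ m × l ≤ a m) →
  ∀ (ε : ℚ) → Positive ε → ∃[ N ] ∀ (n : ℕ) → N ≤ℕ n → l - ε ≤ a n
cauchy∧frequently⇒eventually {a} {l} cauchy frequently ε ε>0 with cauchy ε ε>0
... | N , close with frequently N
...   | m , N≤m , l≤aₘ =
  N , λ n N≤n → ℚ.≤-trans (ℚ.+-monoˡ-≤ (ℚ.- ε) l≤aₘ) (∣p-q∣≤r⇒q-r≤p (close n m N≤n N≤m))

module Parameters (s : ℕ) where

  c b n S : ℕ
  c = 2 * s * s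
  b = 2 * s
  n = c + b + c * b
  S = (c + b) * (c + b) + c * b * b

  -- 27 n⁴ − 4 S³ = 16 s⁴ (27 + 108 s + 362 s² + 660 s³ + 987 s⁴ + 808 s⁵ + 504 s⁶)
  4S³≤27n⁴ : 4 * (S * S * S) ≤ℕ 27 * (n * n * (n * n))
  4S³≤27n⁴ = subst (4 * (S * S * S) ≤ℕ_) (sym (identity s)) (m≤m+n _ _)
    where
    identity : ∀ s →
      27 * ((2 * s * s + 2 * s + 2 * s * s * (2 * s)) * (2 * s * s + 2 * s + 2 * s * s * (2 * s))
            * ((2 * s * s + 2 * s + 2 * s * s * (2 * s)) * (2 * s * s + 2 * s + 2 * s * s * (2 * s))))
      ≡ 4 * (((2 * s * s + 2 * s) * (2 * s * s + 2 * s) + 2 * s * s * (2 * s) * (2 * s))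
             * ((2 * s * s + 2 * s) * (2 * s * s + 2 * s) + 2 * s * s * (2 * s) * (2 * s))
             * ((2 * s * s + 2 * s) * (2 * s * s + 2 * s) + 2 * s * s * (2 * s) * (2 * s)))
        + 16 * (s * s * s * s) * (27 + s * (108 + s * (362 + s * (660 + s * (987 + s * (808 + s * 504))))))
    identity = solve-∀

frequently-4/27≤maxRatio² : ∀ N → ∃[ k ] N ≤ℕ k × + 4 / 27 ≤ maxRatio² k
frequently-4/27≤maxRatio² N = pred n , pred-mono-≤ N<n , maxRatio²-lowerBound f bound
  where
  open Parameters (suc N)
  open BlockMap c b
  f : Fin n → Fin n
  f = blockMap
  N<n : suc N ≤ℕ n
  N<n = ≤-trans (m≤n*m (suc N) 2) (≤-trans (m≤n+m b c) (m≤m+n (c + b) (c * b)))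
  bound : 4 * (fibreSum f * fibreSum f * fibreSum f) ≤ℕ 27 * (fibreSum (f ∘ f) * fibreSum (f ∘ f))
  bound = begin
    4 * (fibreSum f * fibreSum f * fibreSum f)  ≤⟨ *-monoʳ-≤ 4 (*-mono-≤ (*-mono-≤ F₁≤S F₁≤S) F₁≤S) ⟩
    4 * (S * S * S)                             ≤⟨ 4S³≤27n⁴ ⟩
    27 * (n * n * (n * n))                      ≡⟨ cong (λ F₂ → 27 * (F₂ * F₂)) F₂≡n² ⟨
    27 * (fibreSum (f ∘ f) * fibreSum (f ∘ f))  ∎
    where
    open ≤-Reasoning
    F₁≤S : fibreSum f ≤ℕ S
    F₁≤S = fibreSum-blockMap≤ (c * b)
    F₂≡n² : fibreSum (f ∘ f) ≡ n * n
    F₂≡n² = fibreSum-const (blockMap²-const ≤-refl)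

corollary4 : (∀ (ε : ℚ) → Positive ε → ∃[ N ] ∀ (m n : ℕ) → N ≤ℕ m → N ≤ℕ n → ∣ maxRatio² m - maxRatio² n ∣ ≤ ε)
    → ∀ (ε : ℚ) → Positive ε → ∃[ N ] ∀ (n : ℕ) → N ≤ℕ n → + 4 / 27 - ε ≤ maxRatio² n
corollary4 cauchy = cauchy∧frequently⇒eventually cauchy frequently-4/27≤maxRatio²
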